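{- (Completeness for Sequents.) For finite sets of formulas $\Gamma,\Delta$: if $\vDash\Gamma\Rightarrow\Delta$ (i.e. for every structure $\mathfrak{A}$ and every $s\colon V\to|\mathfrak{A}|$, if $\mathfrak{A}$ satisfies every member of $\Gamma$ with $s$ then it satisfies some member of $\Delta$ with $s$), then $\Gamma\Rightarrow\Delta$ is derivable in $\mathbf{CPF}^I$.
   Context: Language $\mathcal{L}$: first-order, with variables $V$ (which may occur free), individual constants, function symbols, predicate symbols, identity $=$, a one-place existence predicate $\exists!$, connectives $\neg,\rightarrow$ (others defined), quantifier $\forall$, and the binary quantifier $I$: if $A,B$ are formulas and $x$ a variable, $Ix[A,B]$ is a formula binding $x$ in $A$ and $B$. $A_t^x$ is substitution of $t$ for $x$ ($t$ free for $x$). Sequents $\Gamma\Rightarrow\Delta$ have finite sets of formulas on each side. The system $\mathbf{CPF}^I$ has axioms $A\Rightarrow A$ and the rules: Cut; weakening and contraction; $(L\neg)$: $\Gamma\Rightarrow\Delta,A$ / $\neg A,\Gamma\Rightarrow\Delta$; $(R\neg)$: $A,\Gamma\Rightarrow\Delta$ / $\Gamma\Rightarrow\Delta,\neg A$; $(L\rightarrow)$: $\Gamma\Rightarrow\Delta,A$ and $B,\Gamma\Rightarrow\Delta$ / $A\rightarrow B,\Gamma\Rightarrow\Delta$; $(R\rightarrow)$: $A,\Gamma\Rightarrow\Delta,B$ / $\Gamma\Rightarrow\Delta,A\rightarrow B$; $(L\forall)$: $A_t^x,\Gamma\Rightarrow\Delta$ / $\exists!t,\forall xA,\Gamma\Rightarrow\Delta$;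 $(R\forall)$: $\exists!a,\Gamma\Rightarrow\Delta,A_a^x$ / $\Gamma\Rightarrow\Delta,\forall xA$; identity: $A_{t_2}^x,\Gamma\Rightarrow\Delta$ / $t_1=t_2,A_{t_1}^x,\Gamma\Rightarrow\Delta$ ($A$ atomic), and $t=t,\Gamma\Rightarrow\Delta$ / $\Gamma\Rightarrow\Delta$; $(RI)$: $\Gamma\Rightarrow\Delta,A_t^x$, $\Gamma\Rightarrow\Delta,B_t^x$, $A_a^x,\Gamma\Rightarrow\Delta,a=t$ / $\Gamma\Rightarrow\Delta,Ix[A,B]$; $(LI^1)$: $A_a^x,B_a^x,\Gamma\Rightarrow\Delta$ / $Ix[A,B],\Gamma\Rightarrow\Delta$; $(LI^2)$: $\Gamma\Rightarrow\Delta,A_{t_1}^x$, $\Gamma\Rightarrow\Delta,A_{t_2}^x$, $\Gamma\Rightarrow\Delta,C_{t_2}^x$ / $Ix[A,B],\Gamma\Rightarrow\Delta,C_{t_1}^x$ ($C$ atomic). In $(R\forall)$, $(RI)$, $(LI^1)$ the eigen-term $a$ must not occur in the conclusion. A structure $\mathfrak{A}$ consists of a non-empty domain $|\mathfrak{A}|$, an inner domain $|\mathfrak{A}^\forall|\subseteq|\mathfrak{A}|$ (possibly empty), which is also the interpretation of $\exists!$, relations $P^\mathfrak{A}\subseteq|\mathfrak{A}|^n$, elements $c^\mathfrak{A}\in|\mathfrak{A}|$, operations $f^\mathfrak{A}\colon|\mathfrak{A}|^n\to|\mathfrak{A}|$. For $s\colon V\to|\mathfrak{A}|$, $\overline{s}$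 is its extension to terms and $s(x|d)$ is $s$ modified to send $x$ to $d$. Satisfaction: $\vDash_\mathfrak{A}t_1=t_2[s]$ iff $\overline{s}(t_1)=\overline{s}(t_2)$; $\vDash_\mathfrak{A}\exists!t[s]$ iff $\overline{s}(t)\in|\mathfrak{A}^\forall|$; atomic $Pt_1\dots t_n$ as usual; $\neg,\rightarrow$ classically; $\vDash_\mathfrak{A}\forall xA[s]$ iff $\vDash_\mathfrak{A}A[s(x|d)]$ for every $d\in|\mathfrak{A}^\forall|$; $\vDash_\mathfrak{A}Ix[A,B][s]$ iff there is $d\in|\mathfrak{A}|$ with $\vDash_\mathfrak{A}A[s(x|d)]$, no other $e\in|\mathfrak{A}|$ with $\vDash_\mathfrak{A}A[s(x|e)]$, and $\vDash_\mathfrak{A}B[s(x|d)]$. -}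

module Defs where

open import Data.Nat using (ℕ; _≟_)
open import Data.Bool using (if_then_else_)
open import Data.Vec using (Vec; []; _∷_)
open import Data.List using (List; []; _∷_; _++_; concatMap)
open import Data.List.Membership.Propositional using (_∈_; _∉_)
open import Data.List.Relation.Unary.All using (All)
open import Data.List.Relation.Unary.Any using (Any)
open import Data.Product using (Σ; _×_)
open import Data.Sum using (_⊎_)
open import Data.Unit using (⊤)
open import Data.Empty using (⊥)
open import Relation.Nullary using (¬_; does)
open import Relation.Binary.PropositionalEquality using (_≡_; _≢_)

-- Function symbols : pairs (n , k) = the k-th n-ary function symbol.
-- Predicate symbols : pairs (n , k) = the k-th n-ary predicate symbol.

Var : Set
Var = ℕ

data Term : Set where
  var : Var → Term
  con : ℕ → Term
  fun : (n k : ℕ) → Vec Term n → Term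

infix  7 _≐_
infixr 5 _⊃_
infix  6 ~_

data Formula : Set where
  rel : (n k : ℕ) → Vec Term n → Formula
  _≐_ : Term → Term → Formula
  E!  : Term → Formula
  ~_  : Formula → Formula
  _⊃_ : Formula → Formula → Formula
  ∀'  : Var → Formula → Formula
  Iq  : Var → Formula → Formula → Formula

Atomic : Formula → Set
Atomic (rel n k ts) = ⊤
Atomic (t₁ ≐ t₂)    = ⊤
Atomic (E! t)       = ⊤
Atomic _            = ⊥

mutual
  varsT : Term → List Var
  varsT (var x)      = x ∷ []
  varsT (con c)      = []
  varsT (fun n k ts) = varsV ts

  varsV : ∀ {n} → Vec Term n → List Var
  varsV []       = []
  varsV (t ∷ ts) = varsT t ++ varsV ts

vars : Formula → List Var
vars (rel n k ts) = varsV ts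
vars (t₁ ≐ t₂)    = varsT t₁ ++ varsT t₂
vars (E! t)       = varsT t
vars (~ A)        = vars A
vars (A ⊃ B)      = vars A ++ vars B
vars (∀' x A)     = x ∷ vars A
vars (Iq x A B)   = x ∷ vars A ++ vars B

varsL : List Formula → List Var
varsL = concatMap vars

FreeIn : Var → Formula → Set
FreeIn x (rel n k ts) = x ∈ varsV ts
FreeIn x (t₁ ≐ t₂)    = x ∈ varsT t₁ ++ varsT t₂
FreeIn x (E! t)       = x ∈ varsT t
FreeIn x (~ A)        = FreeIn x A
FreeIn x (A ⊃ B)      = FreeIn x A ⊎ FreeIn x B
FreeIn x (∀' y A)     = x ≢ y × FreeIn x A
FreeIn x (Iq y A B)   = x ≢ y × (FreeIn x A ⊎ FreeIn x B)

mutual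
  substT : Term → Var → Term → Term
  substT t x (var y)      = if does (x ≟ y) then t else var y
  substT t x (con c)      = con c
  substT t x (fun n k ts) = fun n k (substV t x ts)

  substV : ∀ {n} → Term → Var → Vec Term n → Vec Term n
  substV t x []       = []
  substV t x (u ∷ us) = substT t x u ∷ substV t x us

sub : Formula → Var → Term → Formula
sub (rel n k ts) x t = rel n k (substV t x ts)
sub (t₁ ≐ t₂)    x t = substT t x t₁ ≐ substT t x t₂
sub (E! u)       x t = E! (substT t x u)
sub (~ A)        x t = ~ sub A x t
sub (A ⊃ B)      x t = sub A x t ⊃ sub B x t
sub (∀' y A)     x t = if does (x ≟ y) then ∀' y A else ∀' y (sub A x t)
sub (Iq y A B)   x t = if does (x ≟ y) then Iq y A B else Iq y (sub A x t) (sub B x t)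

FreeFor : Term → Var → Formula → Set
FreeFor t x (rel n k ts) = ⊤
FreeFor t x (u₁ ≐ u₂)    = ⊤
FreeFor t x (E! u)       = ⊤
FreeFor t x (~ A)        = FreeFor t x A
FreeFor t x (A ⊃ B)      = FreeFor t x A × FreeFor t x B
FreeFor t x (∀' y A)     = ¬ FreeIn x (∀' y A) ⊎ (y ∉ varsT t × FreeFor t x A)
FreeFor t x (Iq y A B)   =
  ¬ FreeIn x (Iq y A B) ⊎ (y ∉ varsT t × FreeFor t x A × FreeFor t x B)

-- The sequent calculus CPF^I.  Sequents are pairs of lists read as
-- finite sets (see the rule `set`).

SameSet : List Formula → List Formula → Set
SameSet Γ Γ' = (∀ {A} → A ∈ Γ → A ∈ Γ') × (∀ {A} → A ∈ Γ' → A ∈ Γ)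

FreshSeq : Var → List Formula → List Formula → Set
FreshSeq a Γ Δ = a ∉ varsL Γ × a ∉ varsL Δ

infix 3 _⊢_

data _⊢_ : List Formula → List Formula → Set where
  ax    : ∀ A → (A ∷ []) ⊢ (A ∷ [])
  set   : ∀ {Γ Γ' Δ Δ'} → SameSet Γ Γ' → SameSet Δ Δ' → Γ ⊢ Δ → Γ' ⊢ Δ'
  cut   : ∀ {Γ Δ} A → Γ ⊢ A ∷ Δ → A ∷ Γ ⊢ Δ → Γ ⊢ Δ
  wL    : ∀ {Γ Δ} A → Γ ⊢ Δ → A ∷ Γ ⊢ Δ
  wR    : ∀ {Γ Δ} A → Γ ⊢ Δ → Γ ⊢ A ∷ Δ
  cL    : ∀ {Γ Δ} A → A ∷ A ∷ Γ ⊢ Δ → A ∷ Γ ⊢ Δ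
  cR    : ∀ {Γ Δ} A → Γ ⊢ A ∷ A ∷ Δ → Γ ⊢ A ∷ Δ
  L¬    : ∀ {Γ Δ} A → Γ ⊢ A ∷ Δ → ~ A ∷ Γ ⊢ Δ
  R¬    : ∀ {Γ Δ} A → A ∷ Γ ⊢ Δ → Γ ⊢ ~ A ∷ Δ
  L→    : ∀ {Γ Δ} A B → Γ ⊢ A ∷ Δ → B ∷ Γ ⊢ Δ → (A ⊃ B) ∷ Γ ⊢ Δ
  R→    : ∀ {Γ Δ} A B → A ∷ Γ ⊢ B ∷ Δ → Γ ⊢ (A ⊃ B) ∷ Δ
  L∀    : ∀ {Γ Δ} x A t → FreeFor t x A →
          sub A x t ∷ Γ ⊢ Δ → E! t ∷ ∀' x A ∷ Γ ⊢ Δ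
  R∀    : ∀ {Γ Δ} x A a → FreshSeq a Γ (∀' x A ∷ Δ) → FreeFor (var a) x A →
          E! (var a) ∷ Γ ⊢ sub A x (var a) ∷ Δ → Γ ⊢ ∀' x A ∷ Δ
  =L    : ∀ {Γ Δ} x A t₁ t₂ → Atomic A →
          sub A x t₂ ∷ Γ ⊢ Δ → (t₁ ≐ t₂) ∷ sub A x t₁ ∷ Γ ⊢ Δ
  =refl : ∀ {Γ Δ} t → (t ≐ t) ∷ Γ ⊢ Δ → Γ ⊢ Δ
  RI    : ∀ {Γ Δ} x A B t a →
          FreshSeq a Γ (Iq x A B ∷ Δ) → a ∉ varsT t →
          FreeFor t x A → FreeFor t x B → FreeFor (var a) x A →
          Γ ⊢ sub A x t ∷ Δ → Γ ⊢ sub B x t ∷ Δ →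
          sub A x (var a) ∷ Γ ⊢ (var a ≐ t) ∷ Δ →
          Γ ⊢ Iq x A B ∷ Δ
  LI¹   : ∀ {Γ Δ} x A B a → FreshSeq a (Iq x A B ∷ Γ) Δ →
          FreeFor (var a) x A → FreeFor (var a) x B →
          sub A x (var a) ∷ sub B x (var a) ∷ Γ ⊢ Δ → Iq x A B ∷ Γ ⊢ Δ
  LI²   : ∀ {Γ Δ} x A B C t₁ t₂ → Atomic C →
          FreeFor t₁ x A → FreeFor t₂ x A →
          Γ ⊢ sub A x t₁ ∷ Δ → Γ ⊢ sub A x t₂ ∷ Δ → Γ ⊢ sub C x t₂ ∷ Δ →
          Iq x A B ∷ Γ ⊢ sub C x t₁ ∷ Δ

record Structure : Set₁ where
  field
    Dom    : Set
    elem   : Dom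
    Inner  : Dom → Set                    -- |𝔄^∀| ⊆ |𝔄| (may be empty); = ∃!^𝔄
    relI   : (n k : ℕ) → Vec Dom n → Set
    conI   : ℕ → Dom
    funI   : (n k : ℕ) → Vec Dom n → Dom

module _ (𝔄 : Structure) where
  open Structure 𝔄

  Assignment : Set
  Assignment = Var → Dom

  _[_↦_] : Assignment → Var → Dom → Assignment
  (s [ x ↦ d ]) y = if does (x ≟ y) then d else s y

  mutual
    evalT : Assignment → Term → Dom
    evalT s (var x)      = s x
    evalT s (con c)      = conI c
    evalT s (fun n k ts) = funI n k (evalV s ts)

    evalV : ∀ {n} → Assignment → Vec Term n → Vec Dom n
    evalV s []       = []
    evalV s (t ∷ ts) = evalT s t ∷ evalV s ts

  Sat : Formula → Assignment → Set
  Sat (rel n k ts) s = relI n k (evalV s ts)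
  Sat (t₁ ≐ t₂)    s = evalT s t₁ ≡ evalT s t₂
  Sat (E! t)       s = Inner (evalT s t)
  Sat (~ A)        s = ¬ Sat A s
  Sat (A ⊃ B)      s = Sat A s → Sat B s
  Sat (∀' x A)     s = ∀ d → Inner d → Sat A (s [ x ↦ d ])
  Sat (Iq x A B)   s =
    Σ Dom λ d → Sat A (s [ x ↦ d ])
              × (∀ e → Sat A (s [ x ↦ e ]) → e ≡ d)
              × Sat B (s [ x ↦ d ])

Valid : List Formula → List Formula → Set₁
Valid Γ Δ = ∀ (𝔄 : Structure) (s : Assignment 𝔄) →
            All (λ A → Sat 𝔄 A s) Γ → Any (λ A → Sat 𝔄 A s) Δ

{-# OPTIONS --safe #-}
-- Henkin's method. If Γ ⇒ Δ is underivable, run through an enumeration of all formulas and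
-- extend the sequent stage by stage while keeping it underivable: each formula goes to the left
-- when it is derivable from the current sequent (Cut) and to the right otherwise, together with
-- fresh witnesses licensed by LI¹, R∀ and RI; in addition every term t is equated on the left
-- with ever larger fresh variables a, which is harmless because a = t can be cut away through
-- I z [z = t, z = t]. The limit splits all formulas into accepted and rejected ones. Its term
-- model lives on the variables modulo accepted equality, with the classes whose ∃! is accepted as
-- inner domain, and by induction on the size of formulas it satisfies exactly the accepted ones,
-- so it refutes Γ ⇒ Δ.
module Submission where

open import Defs
open import Level using (0ℓ)
open import Axiom.ExcludedMiddle using (ExcludedMiddle)
open import Data.Bool using (true; false)
open import Data.Empty using (⊥; ⊥-elim)
open import Data.List
  using (List; []; _∷_; _++_; concat; concatMap; map; upTo; cartesianProductWith; cartesianProduct)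
open import Data.List.Extrema.Nat using (max; v≤max⁺)
open import Data.List.Membership.Propositional using (_∈_; _∉_)
open import Data.List.Membership.Propositional.Properties
  using ( ∈-++⁺ˡ; ∈-++⁺ʳ; ∈-++⁻; ∈-map⁺; ∈-upTo⁺; ∈-concat⁺′; ∈-concatMap⁺
        ; ∈-cartesianProductWith⁺; ∈-cartesianProduct⁺)
open import Data.List.Relation.Binary.Subset.Propositional using (_⊆_)
open import Data.List.Relation.Unary.All as All using (All; []; _∷_)
open import Data.List.Relation.Unary.All.Properties using (All¬⇒¬Any)
open import Data.List.Relation.Unary.Any as Any using (Any; here; there)
open import Data.Nat using (ℕ; zero; suc; _≟_; _≤_; _<_; _+_; _⊔_; s≤s; _≤′_; ≤′-refl; ≤′-step)
open import Data.Nat.Properties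
open import Data.Product using (Σ; ∃; _×_; _,_; proj₁; proj₂)
open import Data.Sum using (_⊎_; inj₁; inj₂; [_,_]′)
open import Data.Unit using (⊤; tt)
open import Data.Vec as Vec using (Vec; []; _∷_; _[_]≔_)
open import Data.Fin using (Fin; zero; suc)
open import Data.Vec.Relation.Binary.Pointwise.Inductive as Pointwise using (Pointwise; []; _∷_)
open import Data.Vec.Relation.Unary.All as VecAll using ([]; _∷_)
open import Function using (id; _∘_)
open import Function.Bundles using (_⇔_; mk⇔; Equivalence)
open import Function.Construct.Composition using (_⇔-∘_)
open import Function.Construct.Symmetry using (⇔-sym)
open import Function.Related.TypeIsomorphisms using (→-cong-⇔; ¬-cong-⇔)
open import Relation.Nullary using (¬_; yes; no; does)
open import Relation.Nullary.Decidable using (dec-true; dec-false)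
open import Relation.Binary.Definitions using (tri<; tri≈; tri>)
open import Relation.Binary.PropositionalEquality using (_≡_; _≢_; refl; sym; trans; cong; cong₂; subst)

open Equivalence using (to; from)

-- Variables and substitution

fresh : List Var → Var
fresh xs = suc (max 0 xs)

∈⇒<fresh : ∀ {x xs} → x ∈ xs → x < fresh xs
∈⇒<fresh {xs = xs} x∈xs = s≤s (v≤max⁺ 0 xs (inj₂ (Any.map ≤-reflexive x∈xs)))

fresh≤⇒∉ : ∀ {a xs} → fresh xs ≤ a → a ∉ xs
fresh≤⇒∉ fresh≤a a∈xs = <-irrefl refl (<-≤-trans (∈⇒<fresh a∈xs) fresh≤a)

fresh∉ : ∀ {xs ys} → ys ⊆ xs → fresh xs ∉ ys
fresh∉ ys⊆xs m = fresh≤⇒∉ ≤-refl (ys⊆xs m)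

∈-concatMap⁺′ : ∀ {A B : Set} (f : A → List B) {x xs y} →
                x ∈ xs → y ∈ f x → y ∈ concatMap f xs
∈-concatMap⁺′ f x∈xs y∈fx = ∈-concatMap⁺ f (Any.map (λ { refl → y∈fx }) x∈xs)

∈-varsL : ∀ {A Γ a} → A ∈ Γ → a ∈ vars A → a ∈ varsL Γ
∈-varsL = ∈-concatMap⁺′ vars

∈-varsL-∷ : ∀ {A Γ a} → A ∈ Γ → a ∈ varsL (A ∷ Γ) → a ∈ varsL Γ
∈-varsL-∷ {A} A∈Γ m = [ ∈-varsL A∈Γ , id ]′ (∈-++⁻ (vars A) m)

∉-++ : ∀ {a : Var} {xs ys} → a ∉ xs → a ∉ ys → a ∉ xs ++ ys
∉-++ {xs = xs} a∉xs a∉ys m = [ a∉xs , a∉ys ]′ (∈-++⁻ xs m)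

≟-refl : ∀ x → does (x ≟ x) ≡ true
≟-refl x = dec-true (x ≟ x) refl

≟-≢ : ∀ {x y} → x ≢ y → does (x ≟ y) ≡ false
≟-≢ {x} {y} = dec-false (x ≟ y)

sub-∀-bound : ∀ x A t → sub (∀' x A) x t ≡ ∀' x A
sub-∀-bound x A t rewrite ≟-refl x = refl

sub-∀-free : ∀ {x y} A t → x ≢ y → sub (∀' y A) x t ≡ ∀' y (sub A x t)
sub-∀-free A t x≢y rewrite ≟-≢ x≢y = refl

sub-I-bound : ∀ x A B t → sub (Iq x A B) x t ≡ Iq x A B
sub-I-bound x A B t rewrite ≟-refl x = refl

sub-I-free : ∀ {x y} A B t → x ≢ y → sub (Iq y A B) x t ≡ Iq y (sub A x t) (sub B x t)
sub-I-free A B t x≢y rewrite ≟-≢ x≢y = refl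

mutual
  substT-∉ : ∀ t x u → x ∉ varsT u → substT t x u ≡ u
  substT-∉ t x (var y)      x∉ rewrite ≟-≢ {x} {y} (x∉ ∘ here) = refl
  substT-∉ t x (con c)      x∉ = refl
  substT-∉ t x (fun n k us) x∉ = cong (fun n k) (substV-∉ t x us x∉)

  substV-∉ : ∀ {n} t x (us : Vec Term n) → x ∉ varsV us → substV t x us ≡ us
  substV-∉ t x []       x∉ = refl
  substV-∉ t x (u ∷ us) x∉ =
    cong₂ _∷_ (substT-∉ t x u (x∉ ∘ ∈-++⁺ˡ)) (substV-∉ t x us (x∉ ∘ ∈-++⁺ʳ (varsT u)))

sub-¬FreeIn : ∀ A x t → ¬ FreeIn x A → sub A x t ≡ A
sub-¬FreeIn (rel n k ts) x t x∉ = cong (rel n k) (substV-∉ t x ts x∉)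
sub-¬FreeIn (t₁ ≐ t₂)    x t x∉ =
  cong₂ _≐_ (substT-∉ t x t₁ (x∉ ∘ ∈-++⁺ˡ)) (substT-∉ t x t₂ (x∉ ∘ ∈-++⁺ʳ (varsT t₁)))
sub-¬FreeIn (E! u)       x t x∉ = cong E! (substT-∉ t x u x∉)
sub-¬FreeIn (~ A)        x t x∉ = cong ~_ (sub-¬FreeIn A x t x∉)
sub-¬FreeIn (A ⊃ B)      x t x∉ =
  cong₂ _⊃_ (sub-¬FreeIn A x t (x∉ ∘ inj₁)) (sub-¬FreeIn B x t (x∉ ∘ inj₂))
sub-¬FreeIn (∀' y A)     x t x∉ with x ≟ y
... | yes refl = sub-∀-bound x A t
... | no  x≢y  =
  trans (sub-∀-free A t x≢y) (cong (∀' y) (sub-¬FreeIn A x t (λ f → x∉ (x≢y , f))))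
sub-¬FreeIn (Iq y A B)   x t x∉ with x ≟ y
... | yes refl = sub-I-bound x A B t
... | no  x≢y  = trans (sub-I-free A B t x≢y)
                       (cong₂ (Iq y) (sub-¬FreeIn A x t (λ f → x∉ (x≢y , inj₁ f)))
                                     (sub-¬FreeIn B x t (λ f → x∉ (x≢y , inj₂ f))))

freeFor-∉ : ∀ A x a → a ∉ vars A → FreeFor (var a) x A
freeFor-∉ (rel n k ts) x a a∉ = tt
freeFor-∉ (t₁ ≐ t₂)    x a a∉ = tt
freeFor-∉ (E! t)       x a a∉ = tt
freeFor-∉ (~ A)        x a a∉ = freeFor-∉ A x a a∉
freeFor-∉ (A ⊃ B)      x a a∉ =
  freeFor-∉ A x a (a∉ ∘ ∈-++⁺ˡ) , freeFor-∉ B x a (a∉ ∘ ∈-++⁺ʳ (vars A))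
freeFor-∉ (∀' y A)     x a a∉ =
  inj₂ ((λ { (here refl) → a∉ (here refl) }) , freeFor-∉ A x a (a∉ ∘ there))
freeFor-∉ (Iq y A B)   x a a∉ =
  inj₂ ((λ { (here refl) → a∉ (here refl) }) ,
        freeFor-∉ A x a (a∉ ∘ there ∘ ∈-++⁺ˡ) ,
        freeFor-∉ B x a (a∉ ∘ there ∘ ∈-++⁺ʳ (vars A)))

sub-var≐ : ∀ z w v → z ∉ varsT w → sub (var z ≐ w) z v ≡ (v ≐ w)
sub-var≐ z w v z∉w rewrite ≟-refl z | substT-∉ v z w z∉w = refl

sub-≐var : ∀ z w v → z ∉ varsT w → sub (w ≐ var z) z v ≡ (w ≐ v)
sub-≐var z w v z∉w rewrite ≟-refl z | substT-∉ v z w z∉w = refl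

sub-E!var : ∀ z v → sub (E! (var z)) z v ≡ E! v
sub-E!var z v rewrite ≟-refl z = refl

substV-[]≔ : ∀ {m} z u (ws : Vec Term m) i → z ∉ varsV ws →
             substV u z (ws [ i ]≔ var z) ≡ ws [ i ]≔ u
substV-[]≔ z u (w ∷ ws) zero z∉
  rewrite ≟-refl z | substV-∉ u z ws (z∉ ∘ ∈-++⁺ʳ (varsT w)) = refl
substV-[]≔ z u (w ∷ ws) (suc i) z∉ =
  cong₂ _∷_ (substT-∉ u z w (z∉ ∘ ∈-++⁺ˡ)) (substV-[]≔ z u ws i (z∉ ∘ ∈-++⁺ʳ (varsT w)))

size : Formula → ℕ
size (rel _ _ _) = 1
size (_ ≐ _)     = 1
size (E! _)      = 1
size (~ A)       = suc (size A)
size (A ⊃ B)     = suc (size A + size B)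
size (∀' _ A)    = suc (size A)
size (Iq _ A B)  = suc (size A + size B)

size-sub : ∀ A x t → size (sub A x t) ≡ size A
size-sub (rel _ _ _) x t = refl
size-sub (_ ≐ _)     x t = refl
size-sub (E! _)      x t = refl
size-sub (~ A)       x t = cong suc (size-sub A x t)
size-sub (A ⊃ B)     x t = cong suc (cong₂ _+_ (size-sub A x t) (size-sub B x t))
size-sub (∀' y A)    x t with x ≟ y
... | yes refl rewrite sub-∀-bound x A t = refl
... | no  x≢y  rewrite sub-∀-free A t x≢y = cong suc (size-sub A x t)
size-sub (Iq y A B)  x t with x ≟ y
... | yes refl rewrite sub-I-bound x A B t = refl
... | no  x≢y  rewrite sub-I-free A B t x≢y = cong suc (cong₂ _+_ (size-sub A x t) (size-sub B x t))

module Semantics (𝔄 : Structure) where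
  open Structure 𝔄

  infixl 20 _⟨_↦_⟩

  _⟨_↦_⟩ : Assignment 𝔄 → Var → Dom → Assignment 𝔄
  s ⟨ x ↦ d ⟩ = _[_↦_] 𝔄 s x d

  ⟨↦⟩-other : ∀ s {x} d {z} → x ≢ z → (s ⟨ x ↦ d ⟩) z ≡ s z
  ⟨↦⟩-other s d x≢z rewrite ≟-≢ x≢z = refl

  ⟨↦⟩-comm : ∀ s {x y} e d → x ≢ y →
             ∀ z → (s ⟨ y ↦ d ⟩ ⟨ x ↦ e ⟩) z ≡ (s ⟨ x ↦ e ⟩ ⟨ y ↦ d ⟩) z
  ⟨↦⟩-comm s {x} {y} e d x≢y z with x ≟ z | y ≟ z
  ... | yes refl | yes refl = ⊥-elim (x≢y refl)
  ... | yes refl | no  y≢z  rewrite ≟-refl x | ≟-≢ y≢z = refl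
  ... | no  x≢z  | yes refl rewrite ≟-refl y | ≟-≢ x≢z = refl
  ... | no  x≢z  | no  y≢z  rewrite ≟-≢ x≢z | ≟-≢ y≢z = refl

  ⟨↦⟩-agree : ∀ {P : Var → Set} s s' y d → (∀ z → z ≢ y → P z → s z ≡ s' z) →
              ∀ z → P z → (s ⟨ y ↦ d ⟩) z ≡ (s' ⟨ y ↦ d ⟩) z
  ⟨↦⟩-agree s s' y d agree z Pz with y ≟ z
  ... | yes refl rewrite ≟-refl y = refl
  ... | no  y≢z  rewrite ≟-≢ y≢z = agree z (y≢z ∘ sym) Pz

  Description : (Dom → Set) → (Dom → Set) → Set
  Description P Q = Σ Dom λ d → P d × (∀ e → P e → e ≡ d) × Q d

  Description-cong : ∀ {P P' Q Q' : Dom → Set} → (∀ d → P d ⇔ P' d) → (∀ d → Q d ⇔ Q' d) →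
                     Description P Q ⇔ Description P' Q'
  Description-cong P⇔ Q⇔ = mk⇔
    (λ (d , Pd , unique , Qd) → d , to (P⇔ d) Pd , (λ e → unique e ∘ from (P⇔ e)) , to (Q⇔ d) Qd)
    (λ (d , Pd , unique , Qd) → d , from (P⇔ d) Pd , (λ e → unique e ∘ to (P⇔ e)) , from (Q⇔ d) Qd)

  Inner-∀-cong : ∀ {P P' : Dom → Set} → (∀ d → P d ⇔ P' d) →
                 (∀ d → Inner d → P d) ⇔ (∀ d → Inner d → P' d)
  Inner-∀-cong P⇔ = mk⇔ (λ h d i → to (P⇔ d) (h d i)) (λ h d i → from (P⇔ d) (h d i))

  mutual
    evalT-coincidence : ∀ s s' u → (∀ z → z ∈ varsT u → s z ≡ s' z) →
                        evalT 𝔄 s u ≡ evalT 𝔄 s' u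
    evalT-coincidence s s' (var x)      agree = agree x (here refl)
    evalT-coincidence s s' (con c)      agree = refl
    evalT-coincidence s s' (fun n k us) agree = cong (funI n k) (evalV-coincidence s s' us agree)

    evalV-coincidence : ∀ {n} s s' (us : Vec Term n) → (∀ z → z ∈ varsV us → s z ≡ s' z) →
                        evalV 𝔄 s us ≡ evalV 𝔄 s' us
    evalV-coincidence s s' []       agree = refl
    evalV-coincidence s s' (u ∷ us) agree =
      cong₂ _∷_ (evalT-coincidence s s' u (λ z → agree z ∘ ∈-++⁺ˡ))
                (evalV-coincidence s s' us (λ z → agree z ∘ ∈-++⁺ʳ (varsT u)))

  Sat-coincidence : ∀ A s s' → (∀ z → FreeIn z A → s z ≡ s' z) → Sat 𝔄 A s ⇔ Sat 𝔄 A s'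
  Sat-coincidence (rel n k ts) s s' agree =
    mk⇔ (subst (relI n k) eq) (subst (relI n k) (sym eq))
    where eq = evalV-coincidence s s' ts agree
  Sat-coincidence (t₁ ≐ t₂) s s' agree =
    mk⇔ (λ p → trans (sym eq₁) (trans p eq₂)) (λ p → trans eq₁ (trans p (sym eq₂)))
    where eq₁ = evalT-coincidence s s' t₁ (λ z → agree z ∘ ∈-++⁺ˡ)
          eq₂ = evalT-coincidence s s' t₂ (λ z → agree z ∘ ∈-++⁺ʳ (varsT t₁))
  Sat-coincidence (E! t) s s' agree =
    mk⇔ (subst Inner eq) (subst Inner (sym eq))
    where eq = evalT-coincidence s s' t agree
  Sat-coincidence (~ A) s s' agree = ¬-cong-⇔ (Sat-coincidence A s s' agree)
  Sat-coincidence (A ⊃ B) s s' agree =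
    →-cong-⇔ (Sat-coincidence A s s' (λ z → agree z ∘ inj₁))
             (Sat-coincidence B s s' (λ z → agree z ∘ inj₂))
  Sat-coincidence (∀' y A) s s' agree =
    Inner-∀-cong λ d → Sat-coincidence A _ _ (⟨↦⟩-agree s s' y d (λ z z≢y f → agree z (z≢y , f)))
  Sat-coincidence (Iq y A B) s s' agree =
    Description-cong
      (λ d → Sat-coincidence A _ _ (⟨↦⟩-agree s s' y d (λ z z≢y f → agree z (z≢y , inj₁ f))))
      (λ d → Sat-coincidence B _ _ (⟨↦⟩-agree s s' y d (λ z z≢y f → agree z (z≢y , inj₂ f))))

  Sat-⟨↦⟩-¬FreeIn : ∀ A s x e → ¬ FreeIn x A → Sat 𝔄 A s ⇔ Sat 𝔄 A (s ⟨ x ↦ e ⟩)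
  Sat-⟨↦⟩-¬FreeIn A s x e x∉ = Sat-coincidence A s (s ⟨ x ↦ e ⟩) agree
    where
    agree : ∀ z → FreeIn z A → s z ≡ (s ⟨ x ↦ e ⟩) z
    agree z f with x ≟ z
    ... | yes refl = ⊥-elim (x∉ f)
    ... | no  x≢z  = sym (⟨↦⟩-other s e x≢z)

  evalT-⟨↦⟩-∉ : ∀ s y d t → y ∉ varsT t → evalT 𝔄 (s ⟨ y ↦ d ⟩) t ≡ evalT 𝔄 s t
  evalT-⟨↦⟩-∉ s y d t y∉ = evalT-coincidence (s ⟨ y ↦ d ⟩) s t agree
    where
    agree : ∀ z → z ∈ varsT t → (s ⟨ y ↦ d ⟩) z ≡ s z
    agree z z∈ with y ≟ z
    ... | yes refl = ⊥-elim (y∉ z∈)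
    ... | no  y≢z  = ⟨↦⟩-other s d y≢z

  mutual
    evalT-substT : ∀ s t x u → evalT 𝔄 s (substT t x u) ≡ evalT 𝔄 (s ⟨ x ↦ evalT 𝔄 s t ⟩) u
    evalT-substT s t x (var y) with x ≟ y
    ... | yes refl rewrite ≟-refl x = refl
    ... | no  x≢y  rewrite ≟-≢ x≢y = refl
    evalT-substT s t x (con c)      = refl
    evalT-substT s t x (fun n k us) = cong (funI n k) (evalV-substV s t x us)

    evalV-substV : ∀ {n} s t x (us : Vec Term n) →
                   evalV 𝔄 s (substV t x us) ≡ evalV 𝔄 (s ⟨ x ↦ evalT 𝔄 s t ⟩) us
    evalV-substV s t x []       = refl
    evalV-substV s t x (u ∷ us) = cong₂ _∷_ (evalT-substT s t x u) (evalV-substV s t x us)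

  mutual
    Sat-sub : ∀ A x t s → FreeFor t x A → Sat 𝔄 (sub A x t) s ⇔ Sat 𝔄 A (s ⟨ x ↦ evalT 𝔄 s t ⟩)
    Sat-sub (rel n k ts) x t s _ =
      mk⇔ (subst (relI n k) eq) (subst (relI n k) (sym eq))
      where eq = evalV-substV s t x ts
    Sat-sub (t₁ ≐ t₂) x t s _
      rewrite evalT-substT s t x t₁ | evalT-substT s t x t₂ = mk⇔ id id
    Sat-sub (E! u) x t s _ rewrite evalT-substT s t x u = mk⇔ id id
    Sat-sub (~ A) x t s ff = ¬-cong-⇔ (Sat-sub A x t s ff)
    Sat-sub (A ⊃ B) x t s (ffA , ffB) = →-cong-⇔ (Sat-sub A x t s ffA) (Sat-sub B x t s ffB)
    Sat-sub (∀' y A) x t s ff with x ≟ y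
    ... | yes refl rewrite sub-∀-bound x A t =
      Sat-⟨↦⟩-¬FreeIn (∀' x A) s x _ (λ (x≢x , _) → x≢x refl)
    ... | no x≢y rewrite sub-∀-free A t x≢y with ff
    ...   | inj₁ x∉ rewrite sub-¬FreeIn A x t (λ f → x∉ (x≢y , f)) =
      Sat-⟨↦⟩-¬FreeIn (∀' y A) s x _ x∉
    ...   | inj₂ (y∉t , ffA) = Inner-∀-cong (Sat-sub-under A x≢y y∉t ffA)
    Sat-sub (Iq y A B) x t s ff with x ≟ y
    ... | yes refl rewrite sub-I-bound x A B t =
      Sat-⟨↦⟩-¬FreeIn (Iq x A B) s x _ (λ (x≢x , _) → x≢x refl)
    ... | no x≢y rewrite sub-I-free A B t x≢y with ff
    ...   | inj₁ x∉ rewrite sub-¬FreeIn A x t (λ f → x∉ (x≢y , inj₁ f))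
                          | sub-¬FreeIn B x t (λ f → x∉ (x≢y , inj₂ f)) =
      Sat-⟨↦⟩-¬FreeIn (Iq y A B) s x _ x∉
    ...   | inj₂ (y∉t , ffA , ffB) =
      Description-cong (Sat-sub-under A x≢y y∉t ffA) (Sat-sub-under B x≢y y∉t ffB)

    Sat-sub-under : ∀ A {x y t s} → x ≢ y → y ∉ varsT t → FreeFor t x A → ∀ d →
                    Sat 𝔄 (sub A x t) (s ⟨ y ↦ d ⟩) ⇔ Sat 𝔄 A (s ⟨ x ↦ evalT 𝔄 s t ⟩ ⟨ y ↦ d ⟩)
    Sat-sub-under A {x} {y} {t} {s} x≢y y∉t ffA d
      rewrite sym (evalT-⟨↦⟩-∉ s y d t y∉t) =
      Sat-coincidence A _ _ (λ z _ → ⟨↦⟩-comm s _ d x≢y z) ⇔-∘ Sat-sub A x t (s ⟨ y ↦ d ⟩) ffA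

-- Derived rules

weaken : ∀ {Γ Γ' Δ Δ'} → Γ ⊆ Γ' → Δ ⊆ Δ' → Γ ⊢ Δ → Γ' ⊢ Δ'
weaken {Γ' = Γ'} {Δ' = Δ'} Γ⊆Γ' Δ⊆Δ' d =
  set (merge Γ⊆Γ' , ∈-++⁺ˡ) (merge Δ⊆Δ' , ∈-++⁺ˡ) (weakenʳ* Δ' (weakenˡ* Γ' d))
  where
  merge : ∀ {Σ Σ'} → Σ ⊆ Σ' → Σ' ++ Σ ⊆ Σ'
  merge {Σ' = Σ'} Σ⊆Σ' m = [ id , Σ⊆Σ' ]′ (∈-++⁻ Σ' m)

  weakenˡ* : ∀ {Γ Δ} Σ → Γ ⊢ Δ → Σ ++ Γ ⊢ Δ
  weakenˡ* []      d = d
  weakenˡ* (A ∷ Σ) d = wL A (weakenˡ* Σ d)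

  weakenʳ* : ∀ {Γ Δ} Σ → Γ ⊢ Δ → Γ ⊢ Σ ++ Δ
  weakenʳ* []      d = d
  weakenʳ* (A ∷ Σ) d = wR A (weakenʳ* Σ d)

axiom-∈ : ∀ {Γ Δ} A → A ∈ Γ → A ∈ Δ → Γ ⊢ Δ
axiom-∈ A A∈Γ A∈Δ = weaken (λ { (here refl) → A∈Γ }) (λ { (here refl) → A∈Δ }) (ax A)

≐-reflʳ : ∀ {Γ Δ} t → Γ ⊢ (t ≐ t) ∷ Δ
≐-reflʳ t = =refl t (axiom-∈ (t ≐ t) (here refl) (here refl))

absorbˡ : ∀ {A Γ Δ} → A ∈ Γ → A ∷ Γ ⊢ Δ → Γ ⊢ Δ
absorbˡ A∈Γ = weaken (λ { (here refl) → A∈Γ ; (there m) → m }) id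

absorbʳ : ∀ {A Γ Δ} → A ∈ Δ → Γ ⊢ A ∷ Δ → Γ ⊢ Δ
absorbʳ A∈Δ = weaken id (λ { (here refl) → A∈Δ ; (there m) → m })

-- Cut on I z [z = t, z = t]: RI derives it from reflexivity, and with a as
-- eigen-variable its LI¹ premise is the given sequent.
≐-fresh-elim : ∀ {Γ Δ} t a → a ∉ varsT t → a ∉ varsL Γ → a ∉ varsL Δ →
               (var a ≐ t) ∷ Γ ⊢ Δ → Γ ⊢ Δ
≐-fresh-elim {Γ} {Δ} t a a∉t a∉Γ a∉Δ d =
  cut I (RI z A A t a (a∉Γ , ∉-++ a∉I a∉Δ) a∉t tt tt tt
            (subst (λ X → Γ ⊢ X ∷ Δ) (sym (sub-A t)) (≐-reflʳ t))
            (subst (λ X → Γ ⊢ X ∷ Δ) (sym (sub-A t)) (≐-reflʳ t))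
            (subst (λ X → X ∷ Γ ⊢ (var a ≐ t) ∷ Δ) (sym (sub-A (var a)))
                   (axiom-∈ _ (here refl) (here refl))))
        (LI¹ z A A a (∉-++ a∉I a∉Γ , a∉Δ) tt tt
             (subst (λ X → X ∷ X ∷ Γ ⊢ Δ) (sym (sub-A (var a))) (wL _ d)))
  where
  z = fresh (a ∷ varsT t)
  A = var z ≐ t
  I = Iq z A A

  z∉t : z ∉ varsT t
  z∉t = fresh∉ there

  a≢z : a ≢ z
  a≢z a≡z = fresh∉ id (subst (_∈ a ∷ varsT t) a≡z (here refl))

  sub-A : ∀ u → sub A z u ≡ (u ≐ t)
  sub-A u = sub-var≐ z t u z∉t

  a∉A : a ∉ vars A
  a∉A (here a≡z) = a≢z a≡z
  a∉A (there m)  = a∉t m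

  a∉I : a ∉ vars I
  a∉I (here a≡z) = a≢z a≡z
  a∉I (there m)  = ∉-++ a∉A a∉A m

-- Enumerating the language

Listed : ∀ {X : Set} → (ℕ → List X) → X → Set
Listed f x = ∃ λ N → x ∈ f N

module _ {X : Set} (f : ℕ → List X) (grow : ∀ n → f n ⊆ f (suc n)) where

  ascending : ∀ {m n} → m ≤ n → f m ⊆ f n
  ascending m≤n = go (≤⇒≤′ m≤n)
    where
    go : ∀ {m n} → m ≤′ n → f m ⊆ f n
    go ≤′-refl       = id
    go (≤′-step m≤n) = grow _ ∘ go m≤n

  Listed-bound : ∀ {xs} → All (Listed f) xs → ∃ λ N → xs ⊆ f N
  Listed-bound []                   = 0 , λ ()
  Listed-bound ((n , x∈) ∷ listed) =
    let N , xs⊆ = Listed-bound listed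
    in n ⊔ N , λ { (here refl) → ascending (m≤m⊔n n N) x∈
                 ; (there m)   → ascending (m≤n⊔m n N) (xs⊆ m) }

vectorsOver : ∀ {X : Set} → List X → (m : ℕ) → List (Vec X m)
vectorsOver xs zero    = [] ∷ []
vectorsOver xs (suc m) = cartesianProductWith _∷_ xs (vectorsOver xs m)

∈-vectorsOver : ∀ {X : Set} (xs : List X) {m} {v : Vec X m} →
                VecAll.All (_∈ xs) v → v ∈ vectorsOver xs m
∈-vectorsOver xs []           = here refl
∈-vectorsOver xs (x∈ ∷ v∈) = ∈-cartesianProductWith⁺ _∷_ x∈ (∈-vectorsOver xs v∈)

≤⇒∈upTo : ∀ {i n} → i ≤ n → i ∈ upTo (suc n)
≤⇒∈upTo i≤n = ∈-upTo⁺ (s≤s i≤n)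

mutual
  terms : ℕ → List Term
  terms zero    = []
  terms (suc n) = terms n ++ var n ∷ con n ∷ applications n

  applications : ℕ → List Term
  applications n =
    concatMap (λ m → cartesianProductWith (fun m) (upTo (suc n)) (vectorsOver (terms n) m)) (upTo (suc n))

mutual
  formulas : ℕ → List Formula
  formulas zero    = []
  formulas (suc n) = formulas n ++ concat (newFormulas n)

  newFormulas : ℕ → List (List Formula)
  newFormulas n =
      concatMap (λ m → cartesianProductWith (rel m) (upTo (suc n)) (vectorsOver (terms n) m)) (upTo (suc n))
    ∷ cartesianProductWith _≐_ (terms n) (terms n)
    ∷ map E! (terms n)
    ∷ map ~_ (formulas n)
    ∷ cartesianProductWith _⊃_ (formulas n) (formulas n)
    ∷ cartesianProductWith ∀' (upTo (suc n)) (formulas n)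
    ∷ concatMap (λ x → cartesianProductWith (Iq x) (formulas n) (formulas n)) (upTo (suc n))
    ∷ []

terms-ascending : ∀ {m n} → m ≤ n → terms m ⊆ terms n
terms-ascending = ascending terms (λ n → ∈-++⁺ˡ)

formulas-ascending : ∀ {m n} → m ≤ n → formulas m ⊆ formulas n
formulas-ascending = ascending formulas (λ n → ∈-++⁺ˡ)

∈-newFormulas : ∀ n {A As} → A ∈ As → As ∈ newFormulas n → A ∈ formulas (suc n)
∈-newFormulas n A∈ As∈ = ∈-++⁺ʳ (formulas n) (∈-concat⁺′ A∈ As∈)

mutual
  term-listed : ∀ t → Listed terms t
  term-listed (var x)      = suc x , ∈-++⁺ʳ (terms x) (here refl)
  term-listed (con c)      = suc c , ∈-++⁺ʳ (terms c) (there (here refl))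
  term-listed (fun m k ts) =
    let N , ts∈ = terms-listed ts
        M       = N ⊔ m ⊔ k
    in suc M , ∈-++⁺ʳ (terms M) (there (there
         (∈-concatMap⁺′ (λ m → cartesianProductWith (fun m) (upTo (suc M)) (vectorsOver (terms M) m))
           (≤⇒∈upTo (m≤n⇒m≤n⊔o k (m≤n⊔m N m)))
           (∈-cartesianProductWith⁺ (fun m) (≤⇒∈upTo (m≤n⊔m (N ⊔ m) k))
             (∈-vectorsOver _ (VecAll.map (terms-ascending (m≤n⇒m≤n⊔o k (m≤m⊔n N m))) ts∈))))))

  terms-listed : ∀ {n} (ts : Vec Term n) → ∃ λ N → VecAll.All (_∈ terms N) ts
  terms-listed []       = 0 , []
  terms-listed (t ∷ ts) =
    let N₁ , t∈  = term-listed t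
        N₂ , ts∈ = terms-listed ts
    in N₁ ⊔ N₂ ,
       terms-ascending (m≤m⊔n N₁ N₂) t∈ ∷ VecAll.map (terms-ascending (m≤n⊔m N₁ N₂)) ts∈

formula-listed : ∀ A → Listed formulas A
formula-listed (rel m k ts) =
  let N , ts∈ = terms-listed ts
      M       = N ⊔ m ⊔ k
  in suc M , ∈-newFormulas M
       (∈-concatMap⁺′ (λ m → cartesianProductWith (rel m) (upTo (suc M)) (vectorsOver (terms M) m))
         (≤⇒∈upTo (m≤n⇒m≤n⊔o k (m≤n⊔m N m)))
         (∈-cartesianProductWith⁺ (rel m) (≤⇒∈upTo (m≤n⊔m (N ⊔ m) k))
           (∈-vectorsOver _ (VecAll.map (terms-ascending (m≤n⇒m≤n⊔o k (m≤m⊔n N m))) ts∈))))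
       (here refl)
formula-listed (t₁ ≐ t₂) =
  let N₁ , t₁∈ = term-listed t₁
      N₂ , t₂∈ = term-listed t₂
  in suc (N₁ ⊔ N₂) , ∈-newFormulas (N₁ ⊔ N₂)
       (∈-cartesianProductWith⁺ _≐_ (terms-ascending (m≤m⊔n N₁ N₂) t₁∈)
                                    (terms-ascending (m≤n⊔m N₁ N₂) t₂∈))
       (there (here refl))
formula-listed (E! t) =
  let N , t∈ = term-listed t
  in suc N , ∈-newFormulas N (∈-map⁺ E! t∈) (there (there (here refl)))
formula-listed (~ A) =
  let N , A∈ = formula-listed A
  in suc N , ∈-newFormulas N (∈-map⁺ ~_ A∈) (there (there (there (here refl))))
formula-listed (A ⊃ B) =
  let N₁ , A∈ = formula-listed A
      N₂ , B∈ = formula-listed B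
  in suc (N₁ ⊔ N₂) , ∈-newFormulas (N₁ ⊔ N₂)
       (∈-cartesianProductWith⁺ _⊃_ (formulas-ascending (m≤m⊔n N₁ N₂) A∈)
                                    (formulas-ascending (m≤n⊔m N₁ N₂) B∈))
       (there (there (there (there (here refl)))))
formula-listed (∀' x A) =
  let N , A∈ = formula-listed A
  in suc (N ⊔ x) , ∈-newFormulas (N ⊔ x)
       (∈-cartesianProductWith⁺ ∀' (≤⇒∈upTo (m≤n⊔m N x)) (formulas-ascending (m≤m⊔n N x) A∈))
       (there (there (there (there (there (here refl))))))
formula-listed (Iq x A B) =
  let N₁ , A∈ = formula-listed A
      N₂ , B∈ = formula-listed B
      N       = N₁ ⊔ N₂
  in suc (N ⊔ x) , ∈-newFormulas (N ⊔ x)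
       (∈-concatMap⁺′ (λ y → cartesianProductWith (Iq y) (formulas (N ⊔ x)) (formulas (N ⊔ x)))
         (≤⇒∈upTo (m≤n⊔m N x))
         (∈-cartesianProductWith⁺ (Iq x) (formulas-ascending (m≤n⇒m≤n⊔o x (m≤m⊔n N₁ N₂)) A∈)
                                         (formulas-ascending (m≤n⇒m≤n⊔o x (m≤n⊔m N₁ N₂)) B∈)))
       (there (there (there (there (there (there (here refl)))))))

-- Extending underivable sequents

record Underivable : Set where
  constructor sequent
  field
    left right  : List Formula
    underivable : ¬ (left ⊢ right)
open Underivable public

record _≼_ (s s' : Underivable) : Set where
  constructor extends
  field
    left⊆  : left s ⊆ left s'
    right⊆ : right s ⊆ right s'
open _≼_ public

≼-refl : ∀ {s} → s ≼ s
≼-refl = extends id id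

≼-trans : ∀ {s₁ s₂ s₃} → s₁ ≼ s₂ → s₂ ≼ s₃ → s₁ ≼ s₃
≼-trans (extends l₁₂ r₁₂) (extends l₂₃ r₂₃) = extends (l₂₃ ∘ l₁₂) (r₂₃ ∘ r₁₂)

Extension : Underivable → (Underivable → Set) → Set
Extension s P = ∃ λ s' → s ≼ s' × P s'

usedVars : Underivable → List Var
usedVars s = varsL (left s) ++ varsL (right s)

freshFor : List Var → Underivable → Var
freshFor xs s = fresh (xs ++ usedVars s)

freshFor-∉ : ∀ xs s → freshFor xs s ∉ xs
freshFor-∉ xs s = fresh∉ ∈-++⁺ˡ

freshFor-∉left : ∀ xs s → freshFor xs s ∉ varsL (left s)
freshFor-∉left xs s = fresh∉ (∈-++⁺ʳ xs ∘ ∈-++⁺ˡ)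

freshFor-∉right : ∀ xs s → freshFor xs s ∉ varsL (right s)
freshFor-∉right xs s = fresh∉ (∈-++⁺ʳ xs ∘ ∈-++⁺ʳ (varsL (left s)))

LeftWitness : Formula → List Formula → Set
LeftWitness (Iq x A B) Γ =
  ∃ λ a → a ≢ x × FreeFor (var a) x A × FreeFor (var a) x B ×
          sub A x (var a) ∈ Γ × sub B x (var a) ∈ Γ
LeftWitness _          Γ = ⊤

RightWitness : Formula → Var → List Formula → List Formula → Set
RightWitness (∀' x A)   y Γ Δ = ∃ λ a → FreeFor (var a) x A × E! (var a) ∈ Γ × sub A x (var a) ∈ Δ
RightWitness (Iq x A B) y Γ Δ =
  FreeFor (var y) x A → FreeFor (var y) x B →
  sub A x (var y) ∈ Δ ⊎ sub B x (var y) ∈ Δ ⊎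
  ∃ λ a → FreeFor (var a) x A × sub A x (var a) ∈ Γ × (var a ≐ var y) ∈ Δ
RightWitness _          y Γ Δ = ⊤

EqWitness : Formula → ℕ → List Formula → Set
EqWitness (t ≐ u) n Γ = ∃ λ a → n ≤ a × (var a ≐ t) ∈ Γ
EqWitness _       n Γ = ⊤

Placed : Formula → Var → Underivable → Set
Placed F y s = (F ∈ left s × LeftWitness F (left s)) ⊎ (F ∈ right s × RightWitness F y (left s) (right s))

Settled : Formula → Var → ℕ → Underivable → Set
Settled F y n s = Placed F y s × EqWitness F n (left s)

LeftWitness-mono : ∀ F {Γ Γ'} → Γ ⊆ Γ' → LeftWitness F Γ → LeftWitness F Γ'
LeftWitness-mono (Iq x A B)   Γ⊆ (a , a≢x , ffA , ffB , A∈ , B∈) =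
  a , a≢x , ffA , ffB , Γ⊆ A∈ , Γ⊆ B∈
LeftWitness-mono (rel _ _ _)  Γ⊆ _ = tt
LeftWitness-mono (_ ≐ _)      Γ⊆ _ = tt
LeftWitness-mono (E! _)       Γ⊆ _ = tt
LeftWitness-mono (~ _)        Γ⊆ _ = tt
LeftWitness-mono (_ ⊃ _)      Γ⊆ _ = tt
LeftWitness-mono (∀' _ _)     Γ⊆ _ = tt

RightWitness-mono : ∀ F y {Γ Γ' Δ Δ'} → Γ ⊆ Γ' → Δ ⊆ Δ' →
                    RightWitness F y Γ Δ → RightWitness F y Γ' Δ'
RightWitness-mono (∀' x A)   y Γ⊆ Δ⊆ (a , ff , E∈ , A∈) = a , ff , Γ⊆ E∈ , Δ⊆ A∈
RightWitness-mono (Iq x A B) y Γ⊆ Δ⊆ w ffA ffB with w ffA ffB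
... | inj₁ A∈                       = inj₁ (Δ⊆ A∈)
... | inj₂ (inj₁ B∈)                = inj₂ (inj₁ (Δ⊆ B∈))
... | inj₂ (inj₂ (a , ff , A∈ , E∈)) = inj₂ (inj₂ (a , ff , Γ⊆ A∈ , Δ⊆ E∈))
RightWitness-mono (rel _ _ _) y Γ⊆ Δ⊆ _ = tt
RightWitness-mono (_ ≐ _)     y Γ⊆ Δ⊆ _ = tt
RightWitness-mono (E! _)      y Γ⊆ Δ⊆ _ = tt
RightWitness-mono (~ _)       y Γ⊆ Δ⊆ _ = tt
RightWitness-mono (_ ⊃ _)     y Γ⊆ Δ⊆ _ = tt

EqWitness-mono : ∀ F n {Γ Γ'} → Γ ⊆ Γ' → EqWitness F n Γ → EqWitness F n Γ'
EqWitness-mono (t ≐ u)      n Γ⊆ (a , n≤a , E∈) = a , n≤a , Γ⊆ E∈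
EqWitness-mono (rel _ _ _)  n Γ⊆ _ = tt
EqWitness-mono (E! _)       n Γ⊆ _ = tt
EqWitness-mono (~ _)        n Γ⊆ _ = tt
EqWitness-mono (_ ⊃ _)      n Γ⊆ _ = tt
EqWitness-mono (∀' _ _)     n Γ⊆ _ = tt
EqWitness-mono (Iq _ _ _)   n Γ⊆ _ = tt

Placed-mono : ∀ F y {s s'} → s ≼ s' → Placed F y s → Placed F y s'
Placed-mono F y (extends l⊆ r⊆) (inj₁ (F∈ , w)) = inj₁ (l⊆ F∈ , LeftWitness-mono F l⊆ w)
Placed-mono F y (extends l⊆ r⊆) (inj₂ (F∈ , w)) = inj₂ (r⊆ F∈ , RightWitness-mono F y l⊆ r⊆ w)

Settled-mono : ∀ F y n {s s'} → s ≼ s' → Settled F y n s → Settled F y n s'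
Settled-mono F y n s≼s' (placed , eq) = Placed-mono F y s≼s' placed , EqWitness-mono F n (left⊆ s≼s') eq

witnessˡ : ∀ F s → F ∈ left s → Extension s (LeftWitness F ∘ left)
witnessˡ (Iq x A B) s F∈ =
  sequent (sub A x (var a) ∷ sub B x (var a) ∷ left s) (right s)
          (λ d → underivable s (absorbˡ F∈ (LI¹ x A B a (a∉Γ ∘ ∈-varsL-∷ F∈ , a∉Δ) ffA ffB d))) ,
  extends (there ∘ there) id ,
  (a , a∉F ∘ here , ffA , ffB , here refl , there (here refl))
  where
  a   = freshFor [] s
  a∉Γ = freshFor-∉left [] s
  a∉Δ = freshFor-∉right [] s
  a∉F : a ∉ vars (Iq x A B)
  a∉F = a∉Γ ∘ ∈-varsL F∈
  ffA = freeFor-∉ A x a (a∉F ∘ there ∘ ∈-++⁺ˡ)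
  ffB = freeFor-∉ B x a (a∉F ∘ there ∘ ∈-++⁺ʳ (vars A))
witnessˡ (rel _ _ _) s _ = s , ≼-refl , tt
witnessˡ (_ ≐ _)     s _ = s , ≼-refl , tt
witnessˡ (E! _)      s _ = s , ≼-refl , tt
witnessˡ (~ _)       s _ = s , ≼-refl , tt
witnessˡ (_ ⊃ _)     s _ = s , ≼-refl , tt
witnessˡ (∀' _ _)    s _ = s , ≼-refl , tt

eqWitness : ∀ F n s → Extension s (EqWitness F n ∘ left)
eqWitness (t ≐ u) n s =
  sequent ((var a ≐ t) ∷ left s) (right s)
          (underivable s ∘ ≐-fresh-elim t a (a∉xs ∘ there) (freshFor-∉left xs s) (freshFor-∉right xs s)) ,
  extends there id ,
  (a , <⇒≤ (∈⇒<fresh {xs = xs ++ usedVars s} (here refl)) , here refl)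
  where
  xs   = n ∷ varsT t
  a    = freshFor xs s
  a∉xs = freshFor-∉ xs s
eqWitness (rel _ _ _) n s = s , ≼-refl , tt
eqWitness (E! _)      n s = s , ≼-refl , tt
eqWitness (~ _)       n s = s , ≼-refl , tt
eqWitness (_ ⊃ _)     n s = s , ≼-refl , tt
eqWitness (∀' _ _)    n s = s , ≼-refl , tt
eqWitness (Iq _ _ _)  n s = s , ≼-refl , tt

module Saturation (em : ExcludedMiddle 0ℓ) where

  witnessʳ : ∀ F y s → F ∈ right s → Extension s (λ s' → RightWitness F y (left s') (right s'))
  witnessʳ (∀' x A) y s F∈ =
    sequent (E! (var a) ∷ left s) (sub A x (var a) ∷ right s)
            (λ d → underivable s (absorbʳ F∈ (R∀ x A a (a∉Γ , a∉Δ ∘ ∈-varsL-∷ F∈) ffA d))) ,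
    extends there there ,
    (a , ffA , here refl , here refl)
    where
    a   = freshFor [] s
    a∉Γ = freshFor-∉left [] s
    a∉Δ = freshFor-∉right [] s
    ffA = freeFor-∉ A x a (a∉Δ ∘ ∈-varsL F∈ ∘ there)
  witnessʳ (Iq x A B) y s F∈ with em {FreeFor (var y) x A × FreeFor (var y) x B}
  ... | no ¬ff = s , ≼-refl , λ ffA ffB → ⊥-elim (¬ff (ffA , ffB))
  ... | yes (ffA , ffB) with em {left s ⊢ sub A x (var y) ∷ right s}
  ...   | no ⊬A = sequent (left s) (sub A x (var y) ∷ right s) ⊬A , extends id there ,
                  λ _ _ → inj₁ (here refl)
  ...   | yes ⊢A with em {left s ⊢ sub B x (var y) ∷ right s}
  ...     | no ⊬B = sequent (left s) (sub B x (var y) ∷ right s) ⊬B , extends id there ,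
                    λ _ _ → inj₂ (inj₁ (here refl))
  ...     | yes ⊢B =
    sequent (sub A x (var a) ∷ left s) ((var a ≐ var y) ∷ right s)
            (λ d → underivable s (absorbʳ F∈ (RI x A B (var y) a (a∉Γ , a∉Δ ∘ ∈-varsL-∷ F∈)
                                                     (a∉y ∘ ∈-++⁺ˡ) ffA ffB ffaA ⊢A ⊢B d))) ,
    extends there there ,
    λ _ _ → inj₂ (inj₂ (a , ffaA , here refl , here refl))
    where
    a    = freshFor (y ∷ []) s
    a∉y  = freshFor-∉ (y ∷ []) s
    a∉Γ  = freshFor-∉left (y ∷ []) s
    a∉Δ  = freshFor-∉right (y ∷ []) s
    ffaA = freeFor-∉ A x a (a∉Δ ∘ ∈-varsL F∈ ∘ there ∘ ∈-++⁺ˡ)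
  witnessʳ (rel _ _ _) y s _ = s , ≼-refl , tt
  witnessʳ (_ ≐ _)     y s _ = s , ≼-refl , tt
  witnessʳ (E! _)      y s _ = s , ≼-refl , tt
  witnessʳ (~ _)       y s _ = s , ≼-refl , tt
  witnessʳ (_ ⊃ _)     y s _ = s , ≼-refl , tt

  place : ∀ F y s → Extension s (Placed F y)
  place F y s with em {left s ⊢ F ∷ right s}
  ... | yes ⊢F =
    let s₁ = sequent (F ∷ left s) (right s) (underivable s ∘ cut F ⊢F)
        s₂ , s₁≼s₂ , w = witnessˡ F s₁ (here refl)
    in s₂ , ≼-trans (extends there id) s₁≼s₂ , inj₁ (left⊆ s₁≼s₂ (here refl) , w)
  ... | no ⊬F =
    let s₁ = sequent (left s) (F ∷ right s) ⊬F
        s₂ , s₁≼s₂ , w = witnessʳ F y s₁ (here refl)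
    in s₂ , ≼-trans (extends id there) s₁≼s₂ , inj₂ (right⊆ s₁≼s₂ (here refl) , w)

  settle : ∀ F y n s → Extension s (Settled F y n)
  settle F y n s =
    let s₁ , s≼s₁  , placed = place F y s
        s₂ , s₁≼s₂ , eq     = eqWitness F n s₁
    in s₂ , ≼-trans s≼s₁ s₁≼s₂ , Placed-mono F y s₁≼s₂ placed , eq

  settleAll : ∀ n (tasks : List (Formula × Var)) s →
              Extension s (λ s' → ∀ {F y} → (F , y) ∈ tasks → Settled F y n s')
  settleAll n []                s = s , ≼-refl , λ ()
  settleAll n ((F , y) ∷ tasks) s =
    let s₁ , s≼s₁  , settled  = settle F y n s
        s₂ , s₁≼s₂ , settled* = settleAll n tasks s₁
    in s₂ , ≼-trans s≼s₁ s₁≼s₂ ,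
       λ { (here refl) → Settled-mono F y n s₁≼s₂ settled ; (there m) → settled* m }

record SaturatedPair : Set₁ where
  field
    Accepted Rejected : Formula → Set
    consistent : ∀ {Γ Δ} → All Accepted Γ → All Rejected Δ → ¬ (Γ ⊢ Δ)
    decided    : ∀ A → Accepted A ⊎ Rejected A
    ∀-witness  : ∀ {x A} → Rejected (∀' x A) →
                 ∃ λ a → FreeFor (var a) x A × Accepted (E! (var a)) × Rejected (sub A x (var a))
    I-witnessˡ : ∀ {x A B} → Accepted (Iq x A B) →
                 ∃ λ a → a ≢ x × FreeFor (var a) x A × FreeFor (var a) x B ×
                         Accepted (sub A x (var a)) × Accepted (sub B x (var a))
    I-witnessʳ : ∀ {x A B} → Rejected (Iq x A B) → ∀ y → FreeFor (var y) x A → FreeFor (var y) x B →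
                 Rejected (sub A x (var y)) ⊎ Rejected (sub B x (var y)) ⊎
                 ∃ λ a → FreeFor (var a) x A × Accepted (sub A x (var a)) × Rejected (var a ≐ var y)
    named      : ∀ t xs → ∃ λ a → a ∉ xs × Accepted (var a ≐ t)

module Lindenbaum (em : ExcludedMiddle 0ℓ) (Γ₀ Δ₀ : List Formula) (⊬₀ : ¬ (Γ₀ ⊢ Δ₀)) where
  open Saturation em

  tasks : ℕ → List (Formula × Var)
  tasks n = cartesianProduct (formulas n) (upTo (suc n))

  stage : ℕ → Underivable
  stage zero    = sequent Γ₀ Δ₀ ⊬₀
  stage (suc n) = proj₁ (settleAll n (tasks n) (stage n))

  stage-≼ : ∀ n → stage n ≼ stage (suc n)
  stage-≼ n = proj₁ (proj₂ (settleAll n (tasks n) (stage n)))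

  stage-settled : ∀ {F y n} → F ∈ formulas n → y ≤ n → Settled F y n (stage (suc n))
  stage-settled {n = n} F∈ y≤n =
    proj₂ (proj₂ (settleAll n (tasks n) (stage n))) (∈-cartesianProduct⁺ F∈ (≤⇒∈upTo y≤n))

  settled : ∀ F y k → ∃ λ n → k ≤ n × Settled F y n (stage (suc n))
  settled F y k =
    let N , F∈ = formula-listed F
    in N ⊔ y ⊔ k , m≤n⊔m (N ⊔ y) k ,
       stage-settled (formulas-ascending (m≤n⇒m≤n⊔o k (m≤m⊔n N y)) F∈) (m≤n⇒m≤n⊔o k (m≤n⊔m N y))

  Accepted Rejected : Formula → Set
  Accepted = Listed (left ∘ stage)
  Rejected = Listed (right ∘ stage)

  consistent : ∀ {Γ Δ} → All Accepted Γ → All Rejected Δ → ¬ (Γ ⊢ Δ)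
  consistent acc rej d =
    let N₁ , Γ⊆ = Listed-bound (left ∘ stage) (left⊆ ∘ stage-≼) acc
        N₂ , Δ⊆ = Listed-bound (right ∘ stage) (right⊆ ∘ stage-≼) rej
    in underivable (stage (N₁ ⊔ N₂))
         (weaken (ascending (left ∘ stage) (left⊆ ∘ stage-≼) (m≤m⊔n N₁ N₂) ∘ Γ⊆)
                 (ascending (right ∘ stage) (right⊆ ∘ stage-≼) (m≤n⊔m N₁ N₂) ∘ Δ⊆) d)

  private
    not-both : ∀ {A} → Accepted A → Rejected A → ⊥
    not-both {A} acc rej = consistent (acc ∷ []) (rej ∷ []) (ax A)

  decided : ∀ A → Accepted A ⊎ Rejected A
  decided A with settled A 0 0
  ... | n , _ , inj₁ (A∈ , _) , _ = inj₁ (suc n , A∈)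
  ... | n , _ , inj₂ (A∈ , _) , _ = inj₂ (suc n , A∈)

  ∀-witness : ∀ {x A} → Rejected (∀' x A) →
              ∃ λ a → FreeFor (var a) x A × Accepted (E! (var a)) × Rejected (sub A x (var a))
  ∀-witness {x} {A} rej with settled (∀' x A) 0 0
  ... | n , _ , inj₁ (F∈ , _) , _                   = ⊥-elim (not-both (suc n , F∈) rej)
  ... | n , _ , inj₂ (_ , a , ff , E∈ , A∈) , _ = a , ff , (suc n , E∈) , (suc n , A∈)

  I-witnessˡ : ∀ {x A B} → Accepted (Iq x A B) →
               ∃ λ a → a ≢ x × FreeFor (var a) x A × FreeFor (var a) x B ×
                       Accepted (sub A x (var a)) × Accepted (sub B x (var a))
  I-witnessˡ {x} {A} {B} acc with settled (Iq x A B) 0 0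
  ... | n , _ , inj₂ (F∈ , _) , _ = ⊥-elim (not-both acc (suc n , F∈))
  ... | n , _ , inj₁ (_ , a , a≢x , ffA , ffB , A∈ , B∈) , _ =
    a , a≢x , ffA , ffB , (suc n , A∈) , (suc n , B∈)

  I-witnessʳ : ∀ {x A B} → Rejected (Iq x A B) → ∀ y → FreeFor (var y) x A → FreeFor (var y) x B →
               Rejected (sub A x (var y)) ⊎ Rejected (sub B x (var y)) ⊎
               ∃ λ a → FreeFor (var a) x A × Accepted (sub A x (var a)) × Rejected (var a ≐ var y)
  I-witnessʳ {x} {A} {B} rej y ffA ffB with settled (Iq x A B) y 0
  ... | n , _ , inj₁ (F∈ , _) , _ = ⊥-elim (not-both (suc n , F∈) rej)
  ... | n , _ , inj₂ (_ , w) , _ with w ffA ffB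
  ...   | inj₁ A∈                        = inj₁ (suc n , A∈)
  ...   | inj₂ (inj₁ B∈)                 = inj₂ (inj₁ (suc n , B∈))
  ...   | inj₂ (inj₂ (a , ff , A∈ , E∈)) = inj₂ (inj₂ (a , ff , (suc n , A∈) , (suc n , E∈)))

  named : ∀ t xs → ∃ λ a → a ∉ xs × Accepted (var a ≐ t)
  named t xs with settled (t ≐ t) 0 (fresh xs)
  ... | n , fresh≤n , _ , (a , n≤a , E∈) = a , fresh≤⇒∉ (≤-trans fresh≤n n≤a) , (suc n , E∈)

  saturatedPair : SaturatedPair
  saturatedPair = record
    { Accepted = Accepted ; Rejected = Rejected ; consistent = consistent ; decided = decided
    ; ∀-witness = ∀-witness ; I-witnessˡ = I-witnessˡ ; I-witnessʳ = I-witnessʳ ; named = named }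

  Γ₀-accepted : All Accepted Γ₀
  Γ₀-accepted = All.tabulate (0 ,_)

  Δ₀-rejected : All Rejected Δ₀
  Δ₀-rejected = All.tabulate (0 ,_)

-- The term model

Least : (ℕ → Set) → ℕ → Set
Least P y = P y × (∀ z → z < y → ¬ P z)

least : ExcludedMiddle 0ℓ → (P : ℕ → Set) → ∀ {b} → P b → ∃ (Least P)
least em P {b} Pb = [ (λ below → ⊥-elim (below b ≤-refl Pb)) , id ]′ (search (suc b))
  where
  search : ∀ n → (∀ z → z < n → ¬ P z) ⊎ ∃ (Least P)
  search zero    = inj₁ (λ _ ())
  search (suc n) with search n
  ... | inj₂ found = inj₂ found
  ... | inj₁ below with em {P n}
  ...   | yes Pn = inj₂ (n , Pn , below)
  ...   | no ¬Pn = inj₁ λ z z<1+n → [ below z , (λ { refl → ¬Pn }) ]′ (m<1+n⇒m<n∨m≡n z<1+n)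

Least-unique : ∀ {P Q : ℕ → Set} {y y'} → (∀ z → P z → Q z) → (∀ z → Q z → P z) →
               Least P y → Least Q y' → y ≡ y'
Least-unique {y = y} {y'} P⇒Q Q⇒P (Py , P-below) (Qy' , Q-below) with <-cmp y y'
... | tri< y<y' _ _ = ⊥-elim (Q-below y y<y' (P⇒Q y Py))
... | tri≈ _ y≡y' _ = y≡y'
... | tri> _ _ y'<y = ⊥-elim (P-below y' y'<y (Q⇒P y' Qy'))

module TermModel (em : ExcludedMiddle 0ℓ) (H : SaturatedPair) where
  open SaturatedPair H

  accepted-closed : ∀ {Γ Δ A} → Γ ⊢ A ∷ Δ → All Accepted Γ → All Rejected Δ → Accepted A
  accepted-closed {A = A} d acc rej with decided A
  ... | inj₁ A-acc = A-acc
  ... | inj₂ A-rej = ⊥-elim (consistent acc (A-rej ∷ rej) d)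

  rejected-closed : ∀ {Γ Δ A} → A ∷ Γ ⊢ Δ → All Accepted Γ → All Rejected Δ → Rejected A
  rejected-closed {A = A} d acc rej with decided A
  ... | inj₁ A-acc = ⊥-elim (consistent (A-acc ∷ acc) rej d)
  ... | inj₂ A-rej = A-rej

  not-both : ∀ {A} → Accepted A → Rejected A → ⊥
  not-both {A} acc rej = consistent (acc ∷ []) (rej ∷ []) (ax A)

  ≐-refl-accepted : ∀ t → Accepted (t ≐ t)
  ≐-refl-accepted t = accepted-closed {[]} {[]} (≐-reflʳ t) [] []

  atomic-subst-accepted : ∀ A → Atomic A → ∀ z {u u'} →
                          Accepted (u ≐ u') → Accepted (sub A z u) → Accepted (sub A z u')
  atomic-subst-accepted A atomic z {u} {u'} u≐u' A-acc =
    accepted-closed {_} {[]} (=L z A u u' atomic (ax (sub A z u'))) (u≐u' ∷ A-acc ∷ []) []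

  ≐-sym-accepted : ∀ {u u'} → Accepted (u ≐ u') → Accepted (u' ≐ u)
  ≐-sym-accepted {u} {u'} u≐u' =
    subst Accepted (sub-var≐ z u u' z∉u)
      (atomic-subst-accepted (var z ≐ u) tt z u≐u'
        (subst Accepted (sym (sub-var≐ z u u z∉u)) (≐-refl-accepted u)))
    where
    z   = fresh (varsT u)
    z∉u = fresh∉ id

  ≐-trans-accepted : ∀ {u v w} → Accepted (u ≐ v) → Accepted (v ≐ w) → Accepted (u ≐ w)
  ≐-trans-accepted {u} {v} {w} u≐v v≐w =
    subst Accepted (sub-≐var z u w z∉u)
      (atomic-subst-accepted (u ≐ var z) tt z v≐w (subst Accepted (sym (sub-≐var z u v z∉u)) u≐v))
    where
    z   = fresh (varsT u)
    z∉u = fresh∉ id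

  E!-subst-accepted : ∀ {u u'} → Accepted (u ≐ u') → Accepted (E! u) → Accepted (E! u')
  E!-subst-accepted {u} {u'} u≐u' E!u =
    subst Accepted (sub-E!var 0 u')
      (atomic-subst-accepted (E! (var 0)) tt 0 u≐u' (subst Accepted (sym (sub-E!var 0 u)) E!u))

  _≈⃗_ : ∀ {m} → Vec Term m → Vec Term m → Set
  _≈⃗_ = Pointwise (λ u t → Accepted (u ≐ t))

  ArgumentwiseAtomic : ∀ {m} → (Vec Term m → Formula) → Set
  ArgumentwiseAtomic {m} C =
    ∀ ws (i : Fin m) → ∃ λ A → ∃ λ z → Atomic A × (∀ u → C (ws [ i ]≔ u) ≡ sub A z u)

  argumentwise-subst-accepted : ∀ {m} (C : Vec Term m → Formula) → ArgumentwiseAtomic C →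
                                ∀ {us ts} → us ≈⃗ ts → Accepted (C us) → Accepted (C ts)
  argumentwise-subst-accepted C atomicC []                               C-acc = C-acc
  argumentwise-subst-accepted C atomicC {u ∷ us} {t ∷ ts} (u≐t ∷ us≈ts) C-acc =
    let A , z , atomic , C≡ = atomicC (u ∷ us) zero
    in argumentwise-subst-accepted (λ vs → C (t ∷ vs)) (λ ws i → atomicC (t ∷ ws) (suc i)) us≈ts
         (subst Accepted (sym (C≡ t))
           (atomic-subst-accepted A atomic z u≐t (subst Accepted (C≡ u) C-acc)))

  rel-argumentwiseAtomic : ∀ n k → ArgumentwiseAtomic (rel n k)
  rel-argumentwiseAtomic n k ws i =
    rel n k (ws [ i ]≔ var z) , z , tt , λ u → cong (rel n k) (sym (substV-[]≔ z u ws i (fresh∉ id)))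
    where z = fresh (varsV ws)

  ≐fun-argumentwiseAtomic : ∀ w n k → ArgumentwiseAtomic (λ vs → var w ≐ fun n k vs)
  ≐fun-argumentwiseAtomic w n k ws i =
    (var w ≐ fun n k (ws [ i ]≔ var z)) , z , tt ,
    λ u → cong₂ _≐_ (sym (substT-∉ u z (var w) (fresh∉ {w ∷ varsV ws} λ { (here refl) → here refl })))
                    (cong (fun n k) (sym (substV-[]≔ z u ws i (fresh∉ there))))
    where z = fresh (w ∷ varsV ws)

  _~_ : Var → Var → Set
  a ~ b = Accepted (var a ≐ var b)

  -- Kept abstract: type checking must never unfold the classical search inside least.
  abstract
    least-~ : ∀ b → ∃ (Least (_~ b))
    least-~ b = least em (_~ b) (≐-refl-accepted (var b))

    canonical : Var → Var
    canonical b = proj₁ (least-~ b)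

    canonical-~ : ∀ b → canonical b ~ b
    canonical-~ b = proj₁ (proj₂ (least-~ b))

    canonical-resp : ∀ {a b} → a ~ b → canonical a ≡ canonical b
    canonical-resp {a} {b} a~b =
      Least-unique (λ _ z~a → ≐-trans-accepted z~a a~b)
                   (λ _ z~b → ≐-trans-accepted z~b (≐-sym-accepted a~b))
                   (proj₂ (least-~ a)) (proj₂ (least-~ b))

  Class : Set
  Class = Σ Var λ y → canonical y ≡ y

  [_] : Var → Class
  [ b ] = canonical b , canonical-resp (canonical-~ b)

  rep : Class → Term
  rep d = var (proj₁ d)

  Class-≡ : ∀ {d e : Class} → proj₁ d ≡ proj₁ e → d ≡ e
  Class-≡ {d} {e} refl = cong (proj₁ d ,_) (≡-irrelevant (proj₂ d) (proj₂ e))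

  rep-≐⇒≡ : ∀ (d e : Class) → Accepted (rep d ≐ rep e) → d ≡ e
  rep-≐⇒≡ (a , canonical-a) (b , canonical-b) a~b =
    Class-≡ (trans (sym canonical-a) (trans (canonical-resp a~b) canonical-b))

  []-≡ : ∀ {a b} → a ~ b → [ a ] ≡ [ b ]
  []-≡ a~b = Class-≡ (canonical-resp a~b)

  []-≡⁻ : ∀ {a b} → [ a ] ≡ [ b ] → a ~ b
  []-≡⁻ {a} {b} [a]≡[b] =
    ≐-trans-accepted (≐-sym-accepted (canonical-~ a))
                     (subst (_~ b) (sym (cong proj₁ [a]≡[b])) (canonical-~ b))

  rep-[] : ∀ {b d} → [ b ] ≡ d → Accepted (rep d ≐ var b)
  rep-[] {b} refl = canonical-~ b

  Class-named : ∀ (d : Class) xs → ∃ λ b → b ∉ xs × [ b ] ≡ d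
  Class-named d xs =
    let b , b∉xs , b≐d = named (rep d) xs
    in b , b∉xs , rep-≐⇒≡ [ b ] d (≐-trans-accepted (canonical-~ b) b≐d)

  termModel : Structure
  termModel = record
    { Dom   = Class
    ; elem  = [ 0 ]
    ; Inner = λ d → Accepted (E! (rep d))
    ; relI  = λ n k ds → Accepted (rel n k (Vec.map rep ds))
    ; conI  = λ c → [ proj₁ (named (con c) []) ]
    ; funI  = λ n k ds → [ proj₁ (named (fun n k (Vec.map rep ds)) []) ]
    }

  open Semantics termModel

  mutual
    evalT-accepted : ∀ t → Accepted (rep (evalT termModel [_] t) ≐ t)
    evalT-accepted (var x)      = canonical-~ x
    evalT-accepted (con c)      =
      let a , _ , a≐c = named (con c) [] in ≐-trans-accepted (canonical-~ a) a≐c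
    evalT-accepted (fun n k ts) =
      let a , _ , a≐f = named (fun n k (Vec.map rep (evalV termModel [_] ts))) []
      in ≐-trans-accepted (canonical-~ a)
           (argumentwise-subst-accepted (λ vs → var a ≐ fun n k vs) (≐fun-argumentwiseAtomic a n k)
                                        (evalV-accepted ts) a≐f)

    evalV-accepted : ∀ {m} (ts : Vec Term m) → Vec.map rep (evalV termModel [_] ts) ≈⃗ ts
    evalV-accepted []       = []
    evalV-accepted (t ∷ ts) = evalT-accepted t ∷ evalV-accepted ts

  Truth : Formula → Set
  Truth A = Sat termModel A [_] ⇔ Accepted A

  Instances : Formula → Var → Set
  Instances A x = ∀ t → Truth (sub A x t)

  description-unique-accepted : ∀ {x A B a b} → Accepted (Iq x A B) → a ≢ x →
                                FreeFor (var a) x A → Accepted (sub A x (var a)) →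
                                FreeFor (var b) x A → Accepted (sub A x (var b)) → b ~ a
  description-unique-accepted {x} {A} {B} {a} {b} acc a≢x ffa A-a ffb A-b =
    subst Accepted (C≡ (var b)) (accepted-closed LI²-instance (acc ∷ A-b ∷ A-a ∷ []) [])
    where
    Γ = sub A x (var b) ∷ sub A x (var a) ∷ []

    C≡ : ∀ t → sub (var x ≐ var a) x t ≡ (t ≐ var a)
    C≡ t = sub-var≐ x (var a) t (λ { (here x≡a) → a≢x (sym x≡a) })

    LI²-instance : Iq x A B ∷ Γ ⊢ sub (var x ≐ var a) x (var b) ∷ []
    LI²-instance = LI² x A B (var x ≐ var a) (var b) (var a) tt ffb ffa
      (axiom-∈ _ (here refl) (here refl)) (axiom-∈ _ (there (here refl)) (here refl))
      (subst (λ C → Γ ⊢ C ∷ []) (sym (C≡ (var a))) (≐-reflʳ (var a)))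

  truth-instance : ∀ A x {b d} → [ b ] ≡ d → FreeFor (var b) x A → Instances A x →
                   Sat termModel A ([_] ⟨ x ↦ d ⟩) ⇔ Accepted (sub A x (var b))
  truth-instance A x {b} refl ff truth-A = truth-A (var b) ⇔-∘ ⇔-sym (Sat-sub A x (var b) [_] ff)

  truth-rel : ∀ n k ts → Truth (rel n k ts)
  truth-rel n k ts = mk⇔
    (argumentwise-subst-accepted (rel n k) (rel-argumentwiseAtomic n k) (evalV-accepted ts))
    (argumentwise-subst-accepted (rel n k) (rel-argumentwiseAtomic n k)
                                 (Pointwise.sym ≐-sym-accepted (evalV-accepted ts)))

  truth-≐ : ∀ t₁ t₂ → Truth (t₁ ≐ t₂)
  truth-≐ t₁ t₂ = mk⇔
    (λ t₁≡t₂ → ≐-trans-accepted (≐-sym-accepted (evalT-accepted t₁))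
                 (subst (λ d → Accepted (rep d ≐ t₂)) (sym t₁≡t₂) (evalT-accepted t₂)))
    (λ t₁≐t₂ → rep-≐⇒≡ _ _ (≐-trans-accepted (evalT-accepted t₁)
                             (≐-trans-accepted t₁≐t₂ (≐-sym-accepted (evalT-accepted t₂)))))

  truth-E! : ∀ t → Truth (E! t)
  truth-E! t = mk⇔ (E!-subst-accepted (evalT-accepted t))
                   (E!-subst-accepted (≐-sym-accepted (evalT-accepted t)))

  truth-~ : ∀ A → Truth A → Truth (~ A)
  truth-~ A truth-A = mk⇔
    (λ ¬sat → [ (λ acc → ⊥-elim (¬sat (from truth-A acc)))
              , (λ rej → accepted-closed {[]} (R¬ A (ax A)) [] (rej ∷ [])) ]′ (decided A))
    (λ acc sat → consistent (acc ∷ to truth-A sat ∷ []) [] (L¬ A (ax A)))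

  truth-⊃ : ∀ A B → Truth A → Truth B → Truth (A ⊃ B)
  truth-⊃ A B truth-A truth-B = mk⇔
    (λ imp → [ (λ acc → accepted-closed {B ∷ []} {[]} (R→ A B (axiom-∈ B (there (here refl)) (here refl)))
                                        (to truth-B (imp (from truth-A acc)) ∷ []) [])
             , (λ rej → accepted-closed {[]} {A ∷ []} (R→ A B (axiom-∈ A (here refl) (there (here refl))))
                                        [] (rej ∷ [])) ]′ (decided A))
    (λ acc sat → from truth-B
      (accepted-closed {(A ⊃ B) ∷ A ∷ []} {[]}
        (L→ A B (axiom-∈ A (here refl) (here refl)) (axiom-∈ B (here refl) (here refl)))
        (acc ∷ to truth-A sat ∷ []) []))

  truth-∀ : ∀ x A → Instances A x → Truth (∀' x A)
  truth-∀ x A truth-A = mk⇔ sat⇒acc acc⇒sat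
    where
    sat⇒acc : Sat termModel (∀' x A) [_] → Accepted (∀' x A)
    sat⇒acc sat with decided (∀' x A)
    ... | inj₁ acc = acc
    ... | inj₂ rej =
      let a , ff , E!a , A-rej = ∀-witness rej
          inner = E!-subst-accepted (≐-sym-accepted (canonical-~ a)) E!a
      in ⊥-elim (not-both (to (truth-instance A x refl ff truth-A) (sat [ a ] inner)) A-rej)

    acc⇒sat : Accepted (∀' x A) → Sat termModel (∀' x A) [_]
    acc⇒sat acc d inner =
      let b , b∉A , [b]≡d = Class-named d (vars A)
          ff  = freeFor-∉ A x b b∉A
          E!b = E!-subst-accepted (rep-[] [b]≡d) inner
      in from (truth-instance A x [b]≡d ff truth-A)
           (accepted-closed {E! (var b) ∷ ∀' x A ∷ []} {[]} (L∀ x A (var b) ff (ax _))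
                            (E!b ∷ acc ∷ []) [])

  truth-I : ∀ x A B → Instances A x → Instances B x → Truth (Iq x A B)
  truth-I x A B truth-A truth-B = mk⇔ sat⇒acc acc⇒sat
    where
    sat⇒acc : Sat termModel (Iq x A B) [_] → Accepted (Iq x A B)
    sat⇒acc (d , A-d , unique , B-d) with decided (Iq x A B)
    ... | inj₁ acc = acc
    ... | inj₂ rej =
      let y , y∉AB , [y]≡d = Class-named d (vars A ++ vars B)
          ffA = freeFor-∉ A x y (y∉AB ∘ ∈-++⁺ˡ)
          ffB = freeFor-∉ B x y (y∉AB ∘ ∈-++⁺ʳ (vars A))
          other : ∃ (λ a → FreeFor (var a) x A × Accepted (sub A x (var a)) × Rejected (var a ≐ var y)) →
                  ⊥
          other (a , ffa , A-a , a≐y) =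
            let [a]≡d = unique [ a ] (from (truth-instance A x refl ffa truth-A) A-a)
            in not-both ([]-≡⁻ (trans [a]≡d (sym [y]≡d))) a≐y
      in ⊥-elim ([ not-both (to (truth-instance A x [y]≡d ffA truth-A) A-d)
                 , [ not-both (to (truth-instance B x [y]≡d ffB truth-B) B-d) , other ]′
                 ]′ (I-witnessʳ rej y ffA ffB))

    acc⇒sat : Accepted (Iq x A B) → Sat termModel (Iq x A B) [_]
    acc⇒sat acc =
      let a , a≢x , ffA , ffB , A-a , B-a = I-witnessˡ acc
          unique : ∀ e → Sat termModel A ([_] ⟨ x ↦ e ⟩) → e ≡ [ a ]
          unique e A-e =
            let b , b∉A , [b]≡e = Class-named e (vars A)
                ffb = freeFor-∉ A x b b∉A
                A-b = to (truth-instance A x [b]≡e ffb truth-A) A-e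
            in trans (sym [b]≡e) ([]-≡ (description-unique-accepted acc a≢x ffA A-a ffb A-b))
      in [ a ] , from (truth-instance A x refl ffA truth-A) A-a , unique ,
         from (truth-instance B x refl ffB truth-B) B-a

  mutual
    truth-< : ∀ n A → size A < n → Truth A
    truth-< (suc n) (rel m k ts) _          = truth-rel m k ts
    truth-< (suc n) (t₁ ≐ t₂)    _          = truth-≐ t₁ t₂
    truth-< (suc n) (E! t)       _          = truth-E! t
    truth-< (suc n) (~ A)        (s≤s A<n)  = truth-~ A (truth-< n A A<n)
    truth-< (suc n) (A ⊃ B)      (s≤s AB<n) =
      truth-⊃ A B (truth-< n A (≤-<-trans (m≤m+n (size A) (size B)) AB<n))
                  (truth-< n B (≤-<-trans (m≤n+m (size B) (size A)) AB<n))
    truth-< (suc n) (∀' x A)     (s≤s A<n)  = truth-∀ x A (instances-< n A x A<n)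
    truth-< (suc n) (Iq x A B)   (s≤s AB<n) =
      truth-I x A B (instances-< n A x (≤-<-trans (m≤m+n (size A) (size B)) AB<n))
                    (instances-< n B x (≤-<-trans (m≤n+m (size B) (size A)) AB<n))

    instances-< : ∀ n A x → size A < n → Instances A x
    instances-< n A x A<n t = truth-< n (sub A x t) (subst (_< n) (sym (size-sub A x t)) A<n)

  truth : ∀ A → Truth A
  truth A = truth-< (suc (size A)) A ≤-refl

  accepted-satisfied : ∀ {Γ} → All Accepted Γ → All (λ A → Sat termModel A [_]) Γ
  accepted-satisfied = All.map (from (truth _))

  rejected-unsatisfied : ∀ {Δ} → All Rejected Δ → ¬ Any (λ A → Sat termModel A [_]) Δ
  rejected-unsatisfied = All¬⇒¬Any ∘ All.map (λ rej sat → not-both (to (truth _) sat) rej)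

theorem6 : ExcludedMiddle 0ℓ → (Γ Δ : List Formula) → Valid Γ Δ → Γ ⊢ Δ
theorem6 em Γ Δ valid with em {Γ ⊢ Δ}
... | yes ⊢Γ⇒Δ = ⊢Γ⇒Δ
... | no  ⊬Γ⇒Δ =
  ⊥-elim (rejected-unsatisfied Δ₀-rejected (valid termModel [_] (accepted-satisfied Γ₀-accepted)))
  where
  open Lindenbaum em Γ Δ ⊬Γ⇒Δ using (saturatedPair; Γ₀-accepted; Δ₀-rejected)
  open TermModel em saturatedPair using (termModel; [_]; accepted-satisfied; rejected-unsatisfied)
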